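{- Let $G$ be a $d$-regular graph. Then $\operatorname{dom}(G)=d+1$ if and only if $\chi(G^2)=d+1$, and $\operatorname{fdom}(G)=d+1$ if and only if $\chi_f(G^2)=d+1$.
   Context: $G^2$ is the graph on $V(G)$ in which two distinct vertices are adjacent iff their distance in $G$ is at most $2$. $\chi$ and $\chi_f$ denote the chromatic and fractional chromatic number. $\operatorname{dom}(G)$ is the maximum number of pairwise disjoint dominating sets of $G$. For integers $0<q\le p$, a dominating $(p:q)$-colouring of $G$ is a map $\phi\colon V(G)\to\binom{[p]}{q}$ with $\bigcup_{u\in N[v]}\phi(u)=[p]$ for every vertex $v$ ($N[v]$ the closed neighbourhood); $\operatorname{fdom}(G)$ is the maximum of $p/q$ over such colourings. -}

module Defs where

open import Data.Nat using (ℕ; suc; _*_; _≤_; _<_)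
open import Data.Bool using (Bool; true; false; T)
open import Data.Fin using (Fin)
open import Data.Fin.Subset using (Subset; _∈_; ∣_∣)
open import Data.Vec using (tabulate)
open import Data.Product using (Σ; ∃; _×_)
open import Data.Sum using (_⊎_)
open import Relation.Binary.PropositionalEquality using (_≡_; _≢_)
open import Relation.Nullary using (¬_)

record Graph : Set where
  field
    n      : ℕ
    adj    : Fin n → Fin n → Bool
    sym    : ∀ u v → adj u v ≡ adj v u
    irrefl : ∀ v → adj v v ≡ false

open Graph public

module _ (G : Graph) where

  V : Set
  V = Fin (n G)

  Adj : V → V → Set
  Adj u v = T (adj G u v)

  nbhd : V → Subset (n G)
  nbhd v = tabulate (adj G v)

  degree : V → ℕ
  degree v = ∣ nbhd v ∣

  Regular : ℕ → Set
  Regular d = ∀ v → degree v ≡ d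

  InClosedNbhd : V → V → Set
  InClosedNbhd u v = u ≡ v ⊎ Adj v u

  Adj² : V → V → Set
  Adj² u v = u ≢ v × (Adj u v ⊎ Σ V (λ w → Adj u w × Adj w v))

  Dominating : Subset (n G) → Set
  Dominating D = ∀ v → Σ V (λ u → InClosedNbhd u v × u ∈ D)

  DisjointDominatingFamily : ℕ → Set
  DisjointDominatingFamily m =
    Σ (Fin m → Subset (n G)) λ D →
      (∀ i → Dominating (D i)) ×
      (∀ i j → i ≢ j → ∀ v → v ∈ D i → ¬ (v ∈ D j))

  DomEq : ℕ → Set
  DomEq k = DisjointDominatingFamily k × (∀ m → DisjointDominatingFamily m → m ≤ k)

  DominatingColouring : ℕ → ℕ → Set
  DominatingColouring p q =
    Σ (V → Subset p) λ φ →
      (∀ v → ∣ φ v ∣ ≡ q) ×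
      (∀ v (c : Fin p) → Σ V (λ u → InClosedNbhd u v × c ∈ φ u))

  FdomEq : ℕ → Set
  FdomEq k =
    Σ ℕ (λ p → Σ ℕ λ q → 0 < q × q ≤ p × DominatingColouring p q × p ≡ k * q) ×
    (∀ p q → 0 < q → q ≤ p → DominatingColouring p q → p ≤ k * q)

  ProperColouring² : ℕ → Set
  ProperColouring² k = Σ (V → Fin k) λ c → ∀ u v → Adj² u v → c u ≢ c v

  ChromSqEq : ℕ → Set
  ChromSqEq k = ProperColouring² k × (∀ m → ProperColouring² m → k ≤ m)

  FracColouring² : ℕ → ℕ → Set
  FracColouring² p q =
    Σ (V → Subset p) λ φ →
      (∀ v → ∣ φ v ∣ ≡ q) ×
      (∀ u v → Adj² u v → ∀ (c : Fin p) → c ∈ φ u → ¬ (c ∈ φ v))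

  FracChromSqEq : ℕ → Set
  FracChromSqEq k =
    Σ (ℕ) (λ p → Σ ℕ λ q → 0 < q × FracColouring² p q × p ≡ k * q) ×
    (∀ p q → 0 < q → FracColouring² p q → k * q ≤ p)

-- In a d-regular graph every closed neighbourhood N[x] has exactly d + 1 vertices, and two
-- distinct vertices are adjacent in G² exactly when they lie in a common N[x]. So a colouring
-- of G² is proper iff it is injective on every N[x], and a colouring is dominating iff every
-- colour occurs in every N[x]. Looking at one N[x] gives dom(G) ≤ d + 1 ≤ χ(G²) and
-- fdom(G) ≤ d + 1 ≤ χ_f(G²). At equality, on each N[x] the d + 1 colour sets are pairwise
-- disjoint iff they cover all colours: for injective self-maps of Fin (d + 1) this is
-- surjectivity, and for q-subsets of [p] with p = (d + 1) q it is a counting argument.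
module Submission where

open import Defs
open import Data.Nat using (ℕ; suc)
open import Data.Product using (_×_)
open import Function.Bundles using (_⇔_)

open import Data.Bool using (Bool; T)
open import Data.Bool.Properties using (T-≡)
open import Data.Empty using (⊥-elim)
open import Data.Fin using (Fin; zero; suc; punchOut; _≟_)
open import Data.Fin.Properties using (any?; injective⇒≤; punchOut-injective; suc-injective)
open import Data.Fin.Subset as Subset
  using (Subset; _∈_; _∉_; ∣_∣; _∪_; _∩_; inside; outside)
open import Data.Fin.Subset.Properties
  using (x∈p∪q⁺; x∈p∪q⁻; x∈p∩q⁺; x∈p∩q⁻; Empty-unique; ∉⊥; ∣⊥∣≡0; ∣p∣≤n; ∈⊤; ⊆⊤; ⊆-antisym; ∣⊤∣≡n; ∣p∣≡n⇒p≡⊤)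
open import Data.Nat using (zero; _+_; _*_; _≤_; _<_; z≤n; s≤s)
open import Data.Nat.Properties
  using (+-suc; +-identityʳ; *-identityʳ; m≤m+n; ≤-trans; ≤-reflexive; +-mono-≤; +-mono-≤-<; <-≤-trans; ≤-<-trans; m<m+n; 1+n≰n; <-irrefl)
open import Data.Product using (Σ; ∃; _,_; proj₁; proj₂; map)
open import Data.Sum using (_⊎_; inj₁; inj₂)
open import Data.Vec using ([]; _∷_; tabulate; here; there)
open import Data.Vec.Properties using (lookup∘tabulate; []=⇒lookup; lookup⇒[]=)
open import Function using (_∘_; id)
open import Function.Bundles using (mk⇔; Equivalence)
open import Function.Definitions using (Injective)
open import Relation.Binary.PropositionalEquality as ≡
  using (_≡_; _≢_; refl; cong; cong₂; subst; module ≡-Reasoning)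
open import Relation.Nullary using (¬_; Dec; yes; no; contradiction)
open import Relation.Nullary.Decidable using (isYes; toWitness; fromWitness)

∣p∪q∣+∣p∩q∣≡∣p∣+∣q∣ : ∀ {n} (p q : Subset n) → ∣ p ∪ q ∣ + ∣ p ∩ q ∣ ≡ ∣ p ∣ + ∣ q ∣
∣p∪q∣+∣p∩q∣≡∣p∣+∣q∣ []            []            = refl
∣p∪q∣+∣p∩q∣≡∣p∣+∣q∣ (inside ∷ p)  (inside ∷ q)  = cong suc (begin
  ∣ p ∪ q ∣ + suc ∣ p ∩ q ∣   ≡⟨ +-suc ∣ p ∪ q ∣ ∣ p ∩ q ∣ ⟩
  suc (∣ p ∪ q ∣ + ∣ p ∩ q ∣) ≡⟨ cong suc (∣p∪q∣+∣p∩q∣≡∣p∣+∣q∣ p q) ⟩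
  suc (∣ p ∣ + ∣ q ∣)         ≡⟨ +-suc ∣ p ∣ ∣ q ∣ ⟨
  ∣ p ∣ + suc ∣ q ∣           ∎)
  where open ≡-Reasoning
∣p∪q∣+∣p∩q∣≡∣p∣+∣q∣ (inside ∷ p)  (outside ∷ q) = cong suc (∣p∪q∣+∣p∩q∣≡∣p∣+∣q∣ p q)
∣p∪q∣+∣p∩q∣≡∣p∣+∣q∣ (outside ∷ p) (inside ∷ q)  =
  ≡.trans (cong suc (∣p∪q∣+∣p∩q∣≡∣p∣+∣q∣ p q)) (≡.sym (+-suc ∣ p ∣ ∣ q ∣))
∣p∪q∣+∣p∩q∣≡∣p∣+∣q∣ (outside ∷ p) (outside ∷ q) = ∣p∪q∣+∣p∩q∣≡∣p∣+∣q∣ p q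

∣p∪q∣≤∣p∣+∣q∣ : ∀ {n} (p q : Subset n) → ∣ p ∪ q ∣ ≤ ∣ p ∣ + ∣ q ∣
∣p∪q∣≤∣p∣+∣q∣ p q = ≤-trans (m≤m+n _ _) (≤-reflexive (∣p∪q∣+∣p∩q∣≡∣p∣+∣q∣ p q))

x∈p⇒0<∣p∣ : ∀ {n x} {p : Subset n} → x ∈ p → 0 < ∣ p ∣
x∈p⇒0<∣p∣ {p = inside  ∷ p} _         = s≤s z≤n
x∈p⇒0<∣p∣ {p = outside ∷ p} (there x∈p) = x∈p⇒0<∣p∣ x∈p

x∈p∩q⇒∣p∪q∣<∣p∣+∣q∣ : ∀ {n x} (p q : Subset n) → x ∈ p ∩ q → ∣ p ∪ q ∣ < ∣ p ∣ + ∣ q ∣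
x∈p∩q⇒∣p∪q∣<∣p∣+∣q∣ p q x∈p∩q =
  ≤-trans (m<m+n ∣ p ∪ q ∣ (x∈p⇒0<∣p∣ x∈p∩q)) (≤-reflexive (∣p∪q∣+∣p∩q∣≡∣p∣+∣q∣ p q))

⋃ᶠ : ∀ {k n} → (Fin k → Subset n) → Subset n
⋃ᶠ {zero}  A = Subset.⊥
⋃ᶠ {suc k} A = A zero ∪ ⋃ᶠ (A ∘ suc)

module _ {k n : ℕ} where

  Uniform : (Fin k → Subset n) → ℕ → Set
  Uniform A s = ∀ i → ∣ A i ∣ ≡ s

  Disjoint : (Fin k → Subset n) → Set
  Disjoint A = ∀ i j → i ≢ j → ∀ x → x ∈ A i → x ∉ A j

  Covers : (Fin k → Subset n) → Set
  Covers A = ∀ x → ∃ λ i → x ∈ A i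

∈⋃ᶠ⁺ : ∀ {k n x} (A : Fin k → Subset n) i → x ∈ A i → x ∈ ⋃ᶠ A
∈⋃ᶠ⁺ A zero    x∈A₀ = x∈p∪q⁺ (inj₁ x∈A₀)
∈⋃ᶠ⁺ A (suc i) x∈Aᵢ = x∈p∪q⁺ (inj₂ (∈⋃ᶠ⁺ (A ∘ suc) i x∈Aᵢ))

∈⋃ᶠ⁻ : ∀ {k n x} (A : Fin k → Subset n) → x ∈ ⋃ᶠ A → ∃ λ i → x ∈ A i
∈⋃ᶠ⁻ {zero}  A x∈⊥ = contradiction x∈⊥ ∉⊥
∈⋃ᶠ⁻ {suc k} A x∈⋃ with x∈p∪q⁻ (A zero) (⋃ᶠ (A ∘ suc)) x∈⋃
... | inj₁ x∈A₀ = zero , x∈A₀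
... | inj₂ x∈⋃′ = map suc id (∈⋃ᶠ⁻ (A ∘ suc) x∈⋃′)

Disjoint⇒index-unique : ∀ {k n x} {A : Fin k → Subset n} → Disjoint A →
                        ∀ {i j} → x ∈ A i → x ∈ A j → i ≡ j
Disjoint⇒index-unique disjoint {i} {j} x∈Aᵢ x∈Aⱼ with i ≟ j
... | yes i≡j = i≡j
... | no  i≢j = contradiction x∈Aⱼ (disjoint i j i≢j _ x∈Aᵢ)

module _ {n s : ℕ} where

  ∣⋃ᶠ∣≤k*s : ∀ {k} {A : Fin k → Subset n} → Uniform A s → ∣ ⋃ᶠ A ∣ ≤ k * s
  ∣⋃ᶠ∣≤k*s {zero}      _       = ≤-reflexive (∣⊥∣≡0 n)
  ∣⋃ᶠ∣≤k*s {suc k} {A} uniform = ≤-trans (∣p∪q∣≤∣p∣+∣q∣ (A zero) (⋃ᶠ (A ∘ suc)))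
    (+-mono-≤ (≤-reflexive (uniform zero)) (∣⋃ᶠ∣≤k*s (uniform ∘ suc)))

  ∣⋃ᶠ∣≡k*s : ∀ {k} {A : Fin k → Subset n} → Uniform A s → Disjoint A → ∣ ⋃ᶠ A ∣ ≡ k * s
  ∣⋃ᶠ∣≡k*s {zero}      _       _        = ∣⊥∣≡0 n
  ∣⋃ᶠ∣≡k*s {suc k} {A} uniform disjoint = begin
    ∣ A zero ∪ ⋃ᶠ (A ∘ suc) ∣                              ≡⟨ +-identityʳ _ ⟨
    ∣ A zero ∪ ⋃ᶠ (A ∘ suc) ∣ + 0                          ≡⟨ cong (∣ A zero ∪ ⋃ᶠ (A ∘ suc) ∣ +_) ∣A₀∩⋃∣≡0 ⟨
    ∣ A zero ∪ ⋃ᶠ (A ∘ suc) ∣ + ∣ A zero ∩ ⋃ᶠ (A ∘ suc) ∣ ≡⟨ ∣p∪q∣+∣p∩q∣≡∣p∣+∣q∣ (A zero) _ ⟩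
    ∣ A zero ∣ + ∣ ⋃ᶠ (A ∘ suc) ∣                          ≡⟨ cong₂ _+_ (uniform zero) ∣⋃ᶠA∘suc∣≡k*s ⟩
    s + k * s                                               ∎
    where
    open ≡-Reasoning
    ∣⋃ᶠA∘suc∣≡k*s : ∣ ⋃ᶠ (A ∘ suc) ∣ ≡ k * s
    ∣⋃ᶠA∘suc∣≡k*s = ∣⋃ᶠ∣≡k*s (uniform ∘ suc) (λ i j i≢j → disjoint (suc i) (suc j) (i≢j ∘ suc-injective))
    ∣A₀∩⋃∣≡0 : ∣ A zero ∩ ⋃ᶠ (A ∘ suc) ∣ ≡ 0
    ∣A₀∩⋃∣≡0 = ≡.trans (cong ∣_∣ (Empty-unique λ (x , x∈∩) →
      let x∈A₀ , x∈⋃ = x∈p∩q⁻ (A zero) _ x∈∩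
          i , x∈Aᵢ₊₁ = ∈⋃ᶠ⁻ (A ∘ suc) x∈⋃
      in disjoint zero (suc i) (λ ()) x x∈A₀ x∈Aᵢ₊₁)) (∣⊥∣≡0 n)

  ∣⋃ᶠ∣<k*s : ∀ {k x} {A : Fin k → Subset n} → Uniform A s →
             ∀ {i j} → i ≢ j → x ∈ A i → x ∈ A j → ∣ ⋃ᶠ A ∣ < k * s
  ∣⋃ᶠ∣<k*s {suc k} uniform {zero} {zero} 0≢0 _ _ = contradiction refl 0≢0
  ∣⋃ᶠ∣<k*s {suc k} {A = A} uniform {zero} {suc j} _ x∈A₀ x∈Aⱼ₊₁ = <-≤-trans
    (x∈p∩q⇒∣p∪q∣<∣p∣+∣q∣ (A zero) _ (x∈p∩q⁺ (x∈A₀ , ∈⋃ᶠ⁺ (A ∘ suc) j x∈Aⱼ₊₁)))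
    (+-mono-≤ (≤-reflexive (uniform zero)) (∣⋃ᶠ∣≤k*s (uniform ∘ suc)))
  ∣⋃ᶠ∣<k*s {suc k} {A = A} uniform {suc i} {zero} i≢j x∈Aᵢ x∈Aⱼ =
    ∣⋃ᶠ∣<k*s {A = A} uniform (i≢j ∘ ≡.sym) x∈Aⱼ x∈Aᵢ
  ∣⋃ᶠ∣<k*s {suc k} {A = A} uniform {suc i} {suc j} i≢j x∈Aᵢ x∈Aⱼ = ≤-<-trans
    (∣p∪q∣≤∣p∣+∣q∣ (A zero) _)
    (+-mono-≤-< (≤-reflexive (uniform zero)) (∣⋃ᶠ∣<k*s (uniform ∘ suc) (i≢j ∘ cong suc) x∈Aᵢ x∈Aⱼ))

module _ {k n s : ℕ} {A : Fin k → Subset n} (uniform : Uniform A s) where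

  Disjoint⇒k*s≤n : Disjoint A → k * s ≤ n
  Disjoint⇒k*s≤n disjoint = subst (_≤ n) (∣⋃ᶠ∣≡k*s uniform disjoint) (∣p∣≤n (⋃ᶠ A))

  Covers⇒∣⋃ᶠ∣≡n : Covers A → ∣ ⋃ᶠ A ∣ ≡ n
  Covers⇒∣⋃ᶠ∣≡n covers = ≡.trans
    (cong ∣_∣ (⊆-antisym ⊆⊤ λ {x} _ → let i , x∈Aᵢ = covers x in ∈⋃ᶠ⁺ A i x∈Aᵢ))
    (∣⊤∣≡n n)

  Covers⇒n≤k*s : Covers A → n ≤ k * s
  Covers⇒n≤k*s covers = subst (_≤ k * s) (Covers⇒∣⋃ᶠ∣≡n covers) (∣⋃ᶠ∣≤k*s uniform)

  Covers⇒Disjoint : n ≡ k * s → Covers A → Disjoint A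
  Covers⇒Disjoint n≡k*s covers i j i≢j x x∈Aᵢ x∈Aⱼ =
    <-irrefl (≡.trans (Covers⇒∣⋃ᶠ∣≡n covers) n≡k*s) (∣⋃ᶠ∣<k*s uniform i≢j x∈Aᵢ x∈Aⱼ)

  Disjoint⇒Covers : n ≡ k * s → Disjoint A → Covers A
  Disjoint⇒Covers n≡k*s disjoint x = ∈⋃ᶠ⁻ A (subst (x ∈_) (≡.sym ⋃ᶠA≡⊤) ∈⊤)
    where
    ⋃ᶠA≡⊤ : ⋃ᶠ A ≡ Subset.⊤
    ⋃ᶠA≡⊤ = ∣p∣≡n⇒p≡⊤ (≡.trans (∣⋃ᶠ∣≡k*s uniform disjoint) (≡.sym n≡k*s))

injective⇒surjective : ∀ {k} {f : Fin k → Fin k} → Injective _≡_ _≡_ f → ∀ y → ∃ λ i → f i ≡ y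
injective⇒surjective {suc k} {f} f-injective y with any? (λ i → f i ≟ y)
... | yes y∈im = y∈im
... | no  y∉im = contradiction (injective⇒≤ g-injective) 1+n≰n
  where
  y≢f : ∀ i → y ≢ f i
  y≢f i y≡fᵢ = y∉im (i , ≡.sym y≡fᵢ)
  g : Fin (suc k) → Fin k
  g i = punchOut (y≢f i)
  g-injective : Injective _≡_ _≡_ g
  g-injective = f-injective ∘ punchOut-injective (y≢f _) (y≢f _)

record Enumeration {m} (P : Fin m → Set) (k : ℕ) : Set where
  field
    point     : Fin k → Fin m
    injective : Injective _≡_ _≡_ point
    sound     : ∀ i → P (point i)
    complete  : ∀ {x} → P x → ∃ λ i → point i ≡ x

enumerate : ∀ {m} (p : Subset m) → Enumeration (_∈ p) ∣ p ∣
enumerate [] = record { point = λ () ; injective = λ { {()} } ; sound = λ () ; complete = λ () }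
enumerate (outside ∷ p) = record
  { point     = suc ∘ point
  ; injective = injective ∘ suc-injective
  ; sound     = there ∘ sound
  ; complete  = λ { (there x∈p) → map id (cong suc) (complete x∈p) }
  }
  where open Enumeration (enumerate p)
enumerate (inside ∷ p) = record
  { point     = λ { zero → zero ; (suc i) → suc (point i) }
  ; injective = λ { {zero} {zero} _ → refl ; {suc i} {suc j} eq → cong suc (injective (suc-injective eq)) }
  ; sound     = λ { zero → here ; (suc i) → there (sound i) }
  ; complete  = λ { here → zero , refl ; (there x∈p) → map suc (cong suc) (complete x∈p) }
  }
  where open Enumeration (enumerate p)

Enumeration-resp-⇔ : ∀ {m k} {P Q : Fin m → Set} → (∀ {x} → P x ⇔ Q x) →
                     Enumeration P k → Enumeration Q k
Enumeration-resp-⇔ P⇔Q E = record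
  { point     = point
  ; injective = injective
  ; sound     = Equivalence.to P⇔Q ∘ sound
  ; complete  = complete ∘ Equivalence.from P⇔Q
  }
  where open Enumeration E

insert : ∀ {m k} {P : Fin m → Set} x → ¬ P x → Enumeration P k →
         Enumeration (λ u → u ≡ x ⊎ P u) (suc k)
insert {P = P} x ¬Px E = record
  { point     = point′
  ; injective = λ { {zero} {zero} _ → refl
                  ; {zero} {suc j} x≡pⱼ → contradiction (subst P (≡.sym x≡pⱼ) (sound j)) ¬Px
                  ; {suc i} {zero} pᵢ≡x → contradiction (subst P pᵢ≡x (sound i)) ¬Px
                  ; {suc i} {suc j} eq  → cong suc (injective eq) }
  ; sound     = λ { zero → inj₁ refl ; (suc i) → inj₂ (sound i) }
  ; complete  = λ { (inj₁ u≡x) → zero , ≡.sym u≡x ; (inj₂ Pu) → map suc id (complete Pu) }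
  }
  where
  open Enumeration E
  point′ : Fin (suc _) → Fin _
  point′ zero    = x
  point′ (suc i) = point i

∈-tabulate⇔T : ∀ {m} {f : Fin m → Bool} {x} → x ∈ tabulate f ⇔ T (f x)
∈-tabulate⇔T {f = f} {x} = mk⇔
  (λ x∈f → Equivalence.from T-≡ (≡.trans (≡.sym (lookup∘tabulate f x)) ([]=⇒lookup x∈f)))
  (λ Tfx → lookup⇒[]= x (tabulate f) (≡.trans (lookup∘tabulate f x) (Equivalence.to T-≡ Tfx)))

inhabited? : ∀ m → Dec (Fin m)
inhabited? zero    = no λ ()
inhabited? (suc m) = yes zero

module _ (G : Graph) where

  Adj-sym : ∀ {u v} → Adj G u v → Adj G v u
  Adj-sym {u} {v} = subst T (Graph.sym G u v)

  Adj²⇒common-closedNbhd : ∀ {u w} → Adj² G u w →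
                           ∃ λ x → InClosedNbhd G u x × InClosedNbhd G w x
  Adj²⇒common-closedNbhd {u} (_ , inj₁ u~w)            = u , inj₁ refl , inj₂ u~w
  Adj²⇒common-closedNbhd     (_ , inj₂ (x , u~x , x~w)) = x , inj₂ (Adj-sym u~x) , inj₂ x~w

  common-closedNbhd⇒Adj² : ∀ {u w x} → InClosedNbhd G u x → InClosedNbhd G w x → u ≢ w →
                           Adj² G u w
  common-closedNbhd⇒Adj² (inj₁ refl) (inj₁ refl) u≢w = contradiction refl u≢w
  common-closedNbhd⇒Adj² (inj₁ refl) (inj₂ x~w)  u≢w = u≢w , inj₁ x~w
  common-closedNbhd⇒Adj² (inj₂ x~u)  (inj₁ refl) u≢w = u≢w , inj₁ (Adj-sym x~u)
  common-closedNbhd⇒Adj² (inj₂ x~u)  (inj₂ x~w)  u≢w = u≢w , inj₂ (_ , Adj-sym x~u , x~w)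

  closedNbhd-enumeration : ∀ x → Enumeration (λ u → InClosedNbhd G u x) (suc (degree G x))
  closedNbhd-enumeration x = insert x (subst T (irrefl G x))
    (Enumeration-resp-⇔ ∈-tabulate⇔T (enumerate (nbhd G x)))

  Separated² : ∀ {p} → (V G → Subset p) → Set
  Separated² φ = ∀ u w → Adj² G u w → ∀ c → c ∈ φ u → c ∉ φ w

  ColourDominating : ∀ {p} → (V G → Subset p) → Set
  ColourDominating {p} φ = ∀ v (c : Fin p) → Σ (V G) λ u → InClosedNbhd G u v × c ∈ φ u

  colourClass : ∀ {k} → (V G → Fin k) → Fin k → Subset (n G)
  colourClass c i = tabulate (λ u → isYes (c u ≟ i))

  ∈colourClass⇔ : ∀ {k} {c : V G → Fin k} {i u} → u ∈ colourClass c i ⇔ c u ≡ i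
  ∈colourClass⇔ = mk⇔
    (toWitness ∘ Equivalence.to ∈-tabulate⇔T)
    (Equivalence.from ∈-tabulate⇔T ∘ fromWitness)

  colourClass-disjoint : ∀ {k} (c : V G → Fin k) → Disjoint (colourClass c)
  colourClass-disjoint c i j i≢j u u∈Cᵢ u∈Cⱼ =
    i≢j (≡.trans (≡.sym (Equivalence.to ∈colourClass⇔ u∈Cᵢ)) (Equivalence.to ∈colourClass⇔ u∈Cⱼ))

  -- On the graph without vertices dom and fdom are unbounded while χ(G²) = χ_f(G²) = 0,
  -- so each of the four hypotheses provides a vertex.
  DomEq⇒vertex : ∀ k → DomEq G k → V G
  DomEq⇒vertex k (_ , maximal) with inhabited? (n G)
  ... | yes v = v
  ... | no ¬v = contradiction
    (maximal (suc k) ((λ _ → Subset.⊥) , (λ _ → ⊥-elim ∘ ¬v) , λ _ _ _ → ⊥-elim ∘ ¬v)) 1+n≰n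

  ChromSqEq⇒vertex : ∀ k → ChromSqEq G (suc k) → V G
  ChromSqEq⇒vertex _ (_ , minimal) with inhabited? (n G)
  ... | yes v = v
  ... | no ¬v with () ← minimal 0 (⊥-elim ∘ ¬v , λ u → ⊥-elim (¬v u))

  FdomEq⇒vertex : ∀ k → FdomEq G k → V G
  FdomEq⇒vertex k (_ , maximal) with inhabited? (n G)
  ... | yes v = v
  ... | no ¬v = contradiction
    (subst (suc k ≤_) (*-identityʳ k)
      (maximal (suc k) 1 (s≤s z≤n) (s≤s z≤n) (⊥-elim ∘ ¬v , ⊥-elim ∘ ¬v , ⊥-elim ∘ ¬v)))
    1+n≰n

  FracChromSqEq⇒vertex : ∀ k → FracChromSqEq G (suc k) → V G
  FracChromSqEq⇒vertex _ (_ , minimal) with inhabited? (n G)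
  ... | yes v = v
  ... | no ¬v with () ← minimal 0 1 (s≤s z≤n) (⊥-elim ∘ ¬v , ⊥-elim ∘ ¬v , ⊥-elim ∘ ¬v)

module _ (G : Graph) (d : ℕ) (regular : Regular G d) where

  closedNbhd : ∀ x → Enumeration (λ u → InClosedNbhd G u x) (suc d)
  closedNbhd x = subst (Enumeration _ ∘ suc) (regular x) (closedNbhd-enumeration G x)

  open module ClosedNbhd (x : V G) = Enumeration (closedNbhd x)
    renaming (point to nbr; injective to nbr-injective; sound to nbr-∈N; complete to position)

  nbr-Adj² : ∀ x {i j} → i ≢ j → Adj² G (nbr x i) (nbr x j)
  nbr-Adj² x i≢j = common-closedNbhd⇒Adj² G (nbr-∈N x _) (nbr-∈N x _) (i≢j ∘ nbr-injective x)

  proper⇒injective : ∀ {k} {c : V G → Fin k} → (∀ u w → Adj² G u w → c u ≢ c w) →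
                     ∀ x → Injective _≡_ _≡_ (c ∘ nbr x)
  proper⇒injective proper x {i} {j} cᵢ≡cⱼ with i ≟ j
  ... | yes i≡j = i≡j
  ... | no  i≢j = contradiction cᵢ≡cⱼ (proper _ _ (nbr-Adj² x i≢j))

  module _ {p} {φ : V G → Subset p} where

    Separated²⇒Disjoint : Separated² G φ → ∀ x → Disjoint (φ ∘ nbr x)
    Separated²⇒Disjoint separated x i j i≢j = separated _ _ (nbr-Adj² x i≢j)

    Disjoint⇒Separated² : (∀ x → Disjoint (φ ∘ nbr x)) → Separated² G φ
    Disjoint⇒Separated² disjoint u w u≈w c c∈φu c∈φw
      with x , u∈N , w∈N ← Adj²⇒common-closedNbhd G u≈w
      with i , refl ← position x u∈N | j , refl ← position x w∈N
      = disjoint x i j (λ { refl → proj₁ u≈w refl }) c c∈φu c∈φw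

    ColourDominating⇒Covers : ColourDominating G φ → ∀ x → Covers (φ ∘ nbr x)
    ColourDominating⇒Covers dominating x c
      with u , u∈N , c∈φu ← dominating x c
      with i , refl ← position x u∈N
      = i , c∈φu

    Covers⇒ColourDominating : (∀ x → Covers (φ ∘ nbr x)) → ColourDominating G φ
    Covers⇒ColourDominating covers v c = let i , c∈φᵢ = covers v c in nbr v i , nbr-∈N v i , c∈φᵢ

  FdomEq⇒FracChromSqEq : FdomEq G (suc d) → FracChromSqEq G (suc d)
  FdomEq⇒FracChromSqEq fdom@((p , q , 0<q , _ , (φ , uniform , dominating) , p≡[d+1]q) , _) =
    (p , q , 0<q , (φ , uniform , Disjoint⇒Separated² disjoint) , p≡[d+1]q) , minimal
    where
    disjoint : ∀ x → Disjoint (φ ∘ nbr x)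
    disjoint x = Covers⇒Disjoint (uniform ∘ nbr x) p≡[d+1]q (ColourDominating⇒Covers dominating x)
    minimal : ∀ p′ q′ → 0 < q′ → FracColouring² G p′ q′ → suc d * q′ ≤ p′
    minimal _ _ _ (φ′ , uniform′ , separated′) =
      Disjoint⇒k*s≤n (uniform′ ∘ nbr x₀) (Separated²⇒Disjoint separated′ x₀)
      where x₀ = FdomEq⇒vertex G (suc d) fdom

  FracChromSqEq⇒FdomEq : FracChromSqEq G (suc d) → FdomEq G (suc d)
  FracChromSqEq⇒FdomEq frac@((p , q , 0<q , (φ , uniform , separated) , p≡[d+1]q) , _) =
    (p , q , 0<q , q≤p , (φ , uniform , Covers⇒ColourDominating covers) , p≡[d+1]q) , maximal
    where
    q≤p : q ≤ p
    q≤p = subst (q ≤_) (≡.sym p≡[d+1]q) (m≤m+n q (d * q))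
    covers : ∀ x → Covers (φ ∘ nbr x)
    covers x = Disjoint⇒Covers (uniform ∘ nbr x) p≡[d+1]q (Separated²⇒Disjoint separated x)
    maximal : ∀ p′ q′ → 0 < q′ → q′ ≤ p′ → DominatingColouring G p′ q′ → p′ ≤ suc d * q′
    maximal _ _ _ _ (φ′ , uniform′ , dominating′) =
      Covers⇒n≤k*s (uniform′ ∘ nbr x₀) (ColourDominating⇒Covers dominating′ x₀)
      where x₀ = FracChromSqEq⇒vertex G d frac

  proper⇒colourClass-dominating : {c : V G → Fin (suc d)} → (∀ u w → Adj² G u w → c u ≢ c w) →
                                  ∀ i → Dominating G (colourClass G c i)
  proper⇒colourClass-dominating proper i x =
    let j , cⱼ≡i = injective⇒surjective (proper⇒injective proper x) i
    in nbr x j , nbr-∈N x j , Equivalence.from (∈colourClass⇔ G) cⱼ≡i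

  module Dominators {m} {D : Fin m → Subset (n G)}
                    (dominating : ∀ i → Dominating G (D i)) (disjoint : Disjoint D) where

    dominator : V G → Fin m → V G
    dominator x i = proj₁ (dominating i x)

    dominator-∈D : ∀ x i → dominator x i ∈ D i
    dominator-∈D x i = proj₂ (proj₂ (dominating i x))

    dominator-index : V G → Fin m → Fin (suc d)
    dominator-index x i = proj₁ (position x (proj₁ (proj₂ (dominating i x))))

    nbr-dominator-index : ∀ x i → nbr x (dominator-index x i) ≡ dominator x i
    nbr-dominator-index x i = proj₂ (position x (proj₁ (proj₂ (dominating i x))))

    dominator-index-injective : ∀ x → Injective _≡_ _≡_ (dominator-index x)
    dominator-index-injective x {i} {j} indexᵢ≡indexⱼ =
      Disjoint⇒index-unique disjoint (dominator-∈D x i) (subst (_∈ D j) (≡.sym dᵢ≡dⱼ) (dominator-∈D x j))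
      where
      open ≡-Reasoning
      dᵢ≡dⱼ : dominator x i ≡ dominator x j
      dᵢ≡dⱼ = begin
        dominator x i                 ≡⟨ nbr-dominator-index x i ⟨
        nbr x (dominator-index x i)   ≡⟨ cong (nbr x) indexᵢ≡indexⱼ ⟩
        nbr x (dominator-index x j)   ≡⟨ nbr-dominator-index x j ⟩
        dominator x j                 ∎

  -- With d + 1 sets, `dominator-index x` is a bijection: N[x] meets every D i exactly once.
  module _ {D : Fin (suc d) → Subset (n G)}
           (dominating : ∀ i → Dominating G (D i)) (disjoint : Disjoint D) where

    open Dominators dominating disjoint

    dominator-onto : ∀ x {u} → InClosedNbhd G u x → ∃ λ i → dominator x i ≡ u
    dominator-onto x {u} u∈N =
      let j , nbrⱼ≡u = position x u∈N
          i , indexᵢ≡j = injective⇒surjective (dominator-index-injective x) j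
      in i , (begin
        dominator x i                ≡⟨ nbr-dominator-index x i ⟨
        nbr x (dominator-index x i)  ≡⟨ cong (nbr x) indexᵢ≡j ⟩
        nbr x j                      ≡⟨ nbrⱼ≡u ⟩
        u                            ∎)
      where open ≡-Reasoning

    ∈D⇒dominator : ∀ x {u i} → InClosedNbhd G u x → u ∈ D i → dominator x i ≡ u
    ∈D⇒dominator x u∈N u∈Dᵢ
      with j , refl ← dominator-onto x u∈N
      with refl ← Disjoint⇒index-unique disjoint u∈Dᵢ (dominator-∈D x j)
      = refl

    colour : V G → Fin (suc d)
    colour u = proj₁ (dominator-onto u (inj₁ refl))

    ∈D-colour : ∀ u → u ∈ D (colour u)
    ∈D-colour u = subst (_∈ D (colour u)) (proj₂ (dominator-onto u (inj₁ refl))) (dominator-∈D u (colour u))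

    colour-proper : ∀ u w → Adj² G u w → colour u ≢ colour w
    colour-proper u w u≈w same-colour
      with x , u∈N , w∈N ← Adj²⇒common-closedNbhd G u≈w
      = proj₁ u≈w (begin
        u                       ≡⟨ ∈D⇒dominator x u∈N (∈D-colour u) ⟨
        dominator x (colour u)  ≡⟨ cong (dominator x) same-colour ⟩
        dominator x (colour w)  ≡⟨ ∈D⇒dominator x w∈N (∈D-colour w) ⟩
        w                       ∎)
      where open ≡-Reasoning

  DomEq⇒ChromSqEq : DomEq G (suc d) → ChromSqEq G (suc d)
  DomEq⇒ChromSqEq dom@((D , dominating , disjoint) , _) =
    (colour dominating disjoint , colour-proper dominating disjoint) , minimal
    where
    minimal : ∀ k → ProperColouring² G k → suc d ≤ k
    minimal _ (_ , proper) = injective⇒≤ (proper⇒injective proper (DomEq⇒vertex G (suc d) dom))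

  ChromSqEq⇒DomEq : ChromSqEq G (suc d) → DomEq G (suc d)
  ChromSqEq⇒DomEq chrom@((c , proper) , _) =
    (colourClass G c , proper⇒colourClass-dominating proper , colourClass-disjoint G c) , maximal
    where
    maximal : ∀ m → DisjointDominatingFamily G m → m ≤ suc d
    maximal _ (_ , dominating , disjoint) =
      injective⇒≤ (Dominators.dominator-index-injective dominating disjoint (ChromSqEq⇒vertex G d chrom))

proposition31 : (G : Graph) (d : ℕ) → Regular G d →
    (DomEq G (suc d) ⇔ ChromSqEq G (suc d)) × (FdomEq G (suc d) ⇔ FracChromSqEq G (suc d))
proposition31 G d regular =
  mk⇔ (DomEq⇒ChromSqEq G d regular) (ChromSqEq⇒DomEq G d regular) ,
  mk⇔ (FdomEq⇒FracChromSqEq G d regular) (FracChromSqEq⇒FdomEq G d regular)
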